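{- For every integer $k\ge 3$, every full $k$-ary tree and every $k$-Cayley tree is neighborhood-prime.
   Context: A neighborhood-prime labeling of a simple graph $G$ with $N$ vertices is a bijection $f:V(G)\to\{1,\ldots,N\}$ such that for every vertex $v$ with $\deg(v)>1$, $\gcd\{f(u):u\in N(v)\}=1$, where $N(v)$ is the neighborhood of $v$; a graph admitting one is neighborhood-prime. A full $k$-ary tree is a rooted tree in which every node is either a leaf or has exactly $k$ children. A $k$-Cayley tree is a tree in which every non-leaf vertex has degree exactly $k$. -}

module Defs where

open import Data.Nat using (ℕ; zero; suc; _≤_; _∸_)
open import Data.Nat.GCD using (gcd)
open import Data.Bool using (Bool; true; false; T)
open import Data.Fin using (Fin; toℕ; _≟_)
open import Data.List using (List; []; _∷_; filter; map; foldr; length; allFin)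
open import Data.List.Relation.Unary.Unique.Propositional using (Unique)
open import Data.Product using (Σ; _×_; ∃)
open import Data.Sum using (_⊎_)
open import Data.Unit using (⊤)
open import Data.Empty using (⊥)
open import Relation.Nullary using (¬_; yes; no)
open import Relation.Nullary.Decidable using (⌊_⌋)
open import Relation.Binary.PropositionalEquality using (_≡_)
open import Function.Definitions using (Bijective)

record Graph (n : ℕ) : Set where
  field
    adj   : Fin n → Fin n → Bool
    sym   : ∀ u v → adj u v ≡ adj v u
    loopless : ∀ v → adj v v ≡ false
open Graph public

module _ {n : ℕ} (G : Graph n) where

  Adj : Fin n → Fin n → Set
  Adj u v = T (adj G u v)

  nbhd : Fin n → List (Fin n)
  nbhd v = filter (λ u → T? (adj G v u)) (allFin n)
    where
      open import Data.Bool using (T?)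

  deg : Fin n → ℕ
  deg v = length (nbhd v)

  data Walk : Fin n → Fin n → Set where
    here : ∀ {v} → Walk v v
    step : ∀ {u v w} → Adj u v → Walk v w → Walk u w

  Connected : Set
  Connected = ∀ u v → Walk u v

  ClosedPath : Fin n → List (Fin n) → Set
  ClosedPath x0 [] = ⊤
  ClosedPath x0 (x ∷ []) = Adj x x0
  ClosedPath x0 (x ∷ y ∷ xs) = Adj x y × ClosedPath x0 (y ∷ xs)

  IsCycle : List (Fin n) → Set
  IsCycle [] = ⊥
  IsCycle (x ∷ xs) = 3 ≤ length (x ∷ xs) × Unique (x ∷ xs) × ClosedPath x (x ∷ xs)

  Acyclic : Set
  Acyclic = ∀ cs → ¬ IsCycle cs

  IsTree : Set
  IsTree = 1 ≤ n × Connected × Acyclic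

  -- number of children of v when the tree is rooted at r:
  -- all neighbours for the root, all neighbours but the parent otherwise
  children : Fin n → Fin n → ℕ
  children r v with v ≟ r
  ... | yes _ = deg v
  ... | no  _ = deg v ∸ 1

  IsFullKaryTree : ℕ → Set
  IsFullKaryTree k = IsTree × Σ (Fin n) (λ r → ∀ v → children r v ≡ 0 ⊎ children r v ≡ k)

  IsCayleyTree : ℕ → Set
  IsCayleyTree k = IsTree × (∀ v → 1 < deg v → deg v ≡ k)
    where open import Data.Nat using (_<_)

  gcdList : List ℕ → ℕ
  gcdList = foldr gcd 0

  -- a neighborhood-prime labeling: a bijection V → {1,…,n} (vertex v gets label
  -- 1 + toℕ (f v)) such that every vertex of degree > 1 has neighbourhood labels with gcd 1
  IsNeighborhoodPrimeLabeling : (Fin n → Fin n) → Set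
  IsNeighborhoodPrimeLabeling f =
    Bijective _≡_ _≡_ f ×
    (∀ v → 1 < deg v → gcdList (map (λ u → suc (toℕ (f u))) (nbhd v)) ≡ 1)
    where open import Data.Nat using (_<_)

  NeighborhoodPrime : Set
  NeighborhoodPrime = ∃ IsNeighborhoodPrimeLabeling

module Submission where

-- Rooting the tree anywhere, k ≥ 3 forces every vertex v of degree > 1 to have degree ≥ 3; as at most
-- one neighbour of v is closer to the root, v has two children c₁(v) ≠ c₂(v). A child determines its
-- parent, so these pairs are disjoint, and ranking the vertices by the key 2x, replaced by 2c₁(v) + 1
-- for x = c₂(v), gives a bijective labelling in which c₂(v) is labelled right after c₁(v). Hence N(v)
-- contains two consecutive labels, whose gcd is 1.

open import Defs hiding (sym)
open import Data.Bool using (Bool; true; false; T; if_then_else_; _∧_; _∨_; T?)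
open import Data.Bool.Properties using (T-∧; T-∨)
open import Data.Empty using (⊥-elim)
open import Data.Fin using (Fin; zero; suc; toℕ; fromℕ<; punchOut; _≟_)
open import Data.Fin.Properties
  using (any?; toℕ-fromℕ<; toℕ-injective; punchOut-injective; injective⇒≤)
open import Data.List using (List; []; _∷_; _∷ʳ_; length; filter; map; foldr; allFin)
open import Data.List.Properties using (length-++)
open import Data.List.Membership.Propositional using (_∈_)
open import Data.List.Membership.Propositional.Properties
  using (∈-filter⁺; ∈-filter⁻; ∈-allFin; ∈-map⁺)
open import Data.List.Relation.Unary.All as All using (All; []; _∷_)
open import Data.List.Relation.Unary.All.Properties using (∷ʳ⁺)
open import Data.List.Relation.Unary.AllPairs using ([]; _∷_)
open import Data.List.Relation.Unary.Any using (here; there)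
open import Data.List.Relation.Unary.Unique.Propositional using (Unique)
open import Data.List.Relation.Unary.Unique.Propositional.Properties using (allFin⁺; filter⁺)
open import Data.Nat using (ℕ; zero; suc; _*_; _≤_; _<_; z≤n; s≤s; _<ᵇ_; _≡ᵇ_)
open import Data.Nat.Divisibility using (_∣_; ∣-trans; ∣1⇒≡1; ∣m+n∣m⇒∣n)
open import Data.Nat.GCD using (gcd; gcd[m,n]∣m; gcd[m,n]∣n)
open import Data.Nat.Properties
  using (+-comm; ≤-reflexive; ≤-trans; ≤-antisym; <-trans; ≤-<-trans; <-cmp; n≮n; <⇒≢; <⇒≱; ≮⇒≥;
         m≤n⇒m≤1+n; m≤n+m; suc-injective; <ᵇ⇒<; <⇒<ᵇ; ≡ᵇ⇒≡; ≡⇒≡ᵇ; *-cancelˡ-≡; even≢odd;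
         m∸n≡0⇒m≤n; m∸n≤m)
open import Data.Product using (∃; ∃₂; _×_; _,_; proj₁; proj₂; map₂)
open import Data.Sum as Sum using (_⊎_; inj₁; inj₂)
open import Data.Unit using (tt)
open import Function using (_∘_; Equivalence)
open import Function.Definitions using (Injective; Surjective; Bijective)
open import Relation.Binary.Definitions using (tri<; tri≈; tri>)
open import Relation.Binary.PropositionalEquality
  using (_≡_; _≢_; refl; sym; trans; cong; subst; ≢-sym; module ≡-Reasoning)
open import Relation.Nullary using (¬_; yes; no; contradiction)
open import Relation.Nullary.Decidable using (⌊_⌋; toWitness; fromWitness)

gcdList-∣ : ∀ {x} xs → x ∈ xs → foldr gcd 0 xs ∣ x
gcdList-∣ (y ∷ ys) (here refl)  = gcd[m,n]∣m y (foldr gcd 0 ys)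
gcdList-∣ (y ∷ ys) (there x∈ys) = ∣-trans (gcd[m,n]∣n y (foldr gcd 0 ys)) (gcdList-∣ ys x∈ys)

gcdList-consecutive : ∀ {a} xs → a ∈ xs → suc a ∈ xs → foldr gcd 0 xs ≡ 1
gcdList-consecutive {a} xs a∈xs 1+a∈xs =
  ∣1⇒≡1 (∣m+n∣m⇒∣n (subst (foldr gcd 0 xs ∣_) (+-comm 1 a) (gcdList-∣ xs 1+a∈xs))
                   (gcdList-∣ xs a∈xs))

injective⇒surjective : ∀ {n} {f : Fin n → Fin n} → Injective _≡_ _≡_ f → Surjective _≡_ _≡_ f
injective⇒surjective {suc n} {f} f-injective y with any? (λ x → f x ≟ y)
... | yes (x , fx≡y) = x , λ { refl → fx≡y }
... | no y∉image = ⊥-elim (n≮n n (injective⇒≤ g-injective))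
  where
    g : Fin (suc n) → Fin n
    g x = punchOut {i = y} (λ y≡fx → y∉image (x , sym y≡fx))

    g-injective : Injective _≡_ _≡_ g
    g-injective e = f-injective (punchOut-injective {i = y} _ _ e)

-- Lists

unique-∷ʳ : ∀ {A : Set} {xs : List A} {y} → Unique xs → All (_≢ y) xs → Unique (xs ∷ʳ y)
unique-∷ʳ []              []            = [] ∷ []
unique-∷ʳ (x∉xs ∷ unique) (x≢y ∷ xs≢y) = ∷ʳ⁺ x∉xs x≢y ∷ unique-∷ʳ unique xs≢y

module _ {A : Set} (h : A → ℕ) where

  higher-∉ : ∀ {d y xs} → d < h y → All (λ x → h x ≤ d) xs → All (y ≢_) xs
  higher-∉ {d} d<hy = All.map (λ hx≤d → λ { refl → <⇒≱ d<hy hx≤d })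

  unique-between : ∀ {d u w xs} → u ≢ w → d < h u → d < h w → All (λ x → h x ≤ d) xs →
                   Unique xs → Unique (u ∷ xs ∷ʳ w)
  unique-between u≢w d<hu d<hw low unique =
    ∷ʳ⁺ (higher-∉ d<hu low) u≢w ∷ unique-∷ʳ unique (All.map ≢-sym (higher-∉ d<hw low))

two-satisfying : ∀ {A : Set} {P Q : A → Set} → (∀ {x y} → Q x → Q y → x ≡ y) →
                 ∀ {xs} → Unique xs → 3 ≤ length xs → All (λ x → P x ⊎ Q x) xs →
                 ∃₂ λ x y → x ≢ y × P x × P y
two-satisfying Q-unique {[]}         _ ()              _
two-satisfying Q-unique {_ ∷ []}     _ (s≤s ())        _
two-satisfying Q-unique {_ ∷ _ ∷ []} _ (s≤s (s≤s ())) _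
two-satisfying Q-unique {a ∷ b ∷ c ∷ _} ((a≢b ∷ a≢c ∷ _) ∷ (b≢c ∷ _) ∷ _) _ (pa ∷ pb ∷ pc ∷ _)
  with pa | pb | pc
... | inj₁ Pa | inj₁ Pb | _       = a , b , a≢b , Pa , Pb
... | inj₁ Pa | inj₂ Qb | inj₁ Pc = a , c , a≢c , Pa , Pc
... | inj₂ Qa | inj₁ Pb | inj₁ Pc = b , c , b≢c , Pb , Pc
... | inj₁ _  | inj₂ Qb | inj₂ Qc = ⊥-elim (b≢c (Q-unique Qb Qc))
... | inj₂ Qa | inj₁ _  | inj₂ Qc = ⊥-elim (a≢c (Q-unique Qa Qc))
... | inj₂ Qa | inj₂ Qb | _       = ⊥-elim (a≢b (Q-unique Qa Qb))

firstTwo : ∀ {A : Set} → A → List A → A × A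
firstTwo _ (a ∷ b ∷ _) = a , b
firstTwo d _           = d , d

firstTwo-distinct : ∀ {A : Set} (d : A) {xs x y} → Unique xs → x ∈ xs → y ∈ xs → x ≢ y →
                    let (a , b) = firstTwo d xs in a ≢ b × a ∈ xs × b ∈ xs
firstTwo-distinct d {a ∷ []}    _               (here refl) (here refl) x≢y = ⊥-elim (x≢y refl)
firstTwo-distinct d {a ∷ b ∷ _} ((a≢b ∷ _) ∷ _) _           _           _   = a≢b , here refl , there (here refl)

-- Counting and ranking

count : ∀ {n} → (Fin n → Bool) → ℕ
count {zero}  p = 0
count {suc n} p = if p zero then suc (count (p ∘ suc)) else count (p ∘ suc)

count≤n : ∀ {n} (p : Fin n → Bool) → count p ≤ n
count≤n {zero}  p = z≤n
count≤n {suc n} p with p zero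
... | true  = s≤s (count≤n (p ∘ suc))
... | false = m≤n⇒m≤1+n (count≤n (p ∘ suc))

count<n : ∀ {n} (p : Fin n → Bool) j → ¬ T (p j) → count p < n
count<n {suc n} p zero ¬p0 with p zero
... | true  = ⊥-elim (¬p0 tt)
... | false = s≤s (count≤n (p ∘ suc))
count<n {suc n} p (suc j) ¬pj with p zero
... | true  = s≤s (count<n (p ∘ suc) j ¬pj)
... | false = s≤s (count≤n (p ∘ suc))

count-mono : ∀ {n} (p q : Fin n → Bool) → (∀ i → T (p i) → T (q i)) → count p ≤ count q
count-mono {zero}  p q p⊆q = z≤n
count-mono {suc n} p q p⊆q with p zero | q zero | p⊆q zero
... | true  | true  | _     = s≤s (count-mono (p ∘ suc) (q ∘ suc) (p⊆q ∘ suc))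
... | true  | false | p0⇒q0 = ⊥-elim (p0⇒q0 tt)
... | false | true  | _     = m≤n⇒m≤1+n (count-mono (p ∘ suc) (q ∘ suc) (p⊆q ∘ suc))
... | false | false | _     = count-mono (p ∘ suc) (q ∘ suc) (p⊆q ∘ suc)

count-< : ∀ {n} (p q : Fin n → Bool) → (∀ i → T (p i) → T (q i)) → ∀ j → ¬ T (p j) → T (q j) →
          count p < count q
count-< {suc n} p q p⊆q zero ¬p0 q0 with p zero | q zero
... | true  | _     = ⊥-elim (¬p0 tt)
... | false | true  = s≤s (count-mono (p ∘ suc) (q ∘ suc) (p⊆q ∘ suc))
... | false | false = ⊥-elim q0
count-< {suc n} p q p⊆q (suc j) ¬pj qj with p zero | q zero | p⊆q zero
... | true  | true  | _     = s≤s (count-< (p ∘ suc) (q ∘ suc) (p⊆q ∘ suc) j ¬pj qj)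
... | true  | false | p0⇒q0 = ⊥-elim (p0⇒q0 tt)
... | false | true  | _     = m≤n⇒m≤1+n (count-< (p ∘ suc) (q ∘ suc) (p⊆q ∘ suc) j ¬pj qj)
... | false | false | _     = count-< (p ∘ suc) (q ∘ suc) (p⊆q ∘ suc) j ¬pj qj

count-cong : ∀ {n} (p q : Fin n → Bool) → (∀ i → p i ≡ q i) → count p ≡ count q
count-cong {zero}  p q p≗q = refl
count-cong {suc n} p q p≗q rewrite p≗q zero | count-cong (p ∘ suc) (q ∘ suc) (p≗q ∘ suc) = refl

count-insert : ∀ {n} (p q : Fin n → Bool) j → (∀ i → i ≢ j → p i ≡ q i) →
               ¬ T (p j) → T (q j) → count q ≡ suc (count p)
count-insert {suc n} p q zero p≗q ¬p0 q0 with p zero | q zero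
... | true  | _     = ⊥-elim (¬p0 tt)
... | false | false = ⊥-elim q0
... | false | true  = cong suc (count-cong (q ∘ suc) (p ∘ suc) (λ i → sym (p≗q (suc i) λ ())))
count-insert {suc n} p q (suc j) p≗q ¬pj qj
  rewrite p≗q zero (λ ())
        | count-insert (p ∘ suc) (q ∘ suc) j (λ i i≢j → p≗q (suc i) λ { refl → i≢j refl }) ¬pj qj
  with q zero
... | true  = refl
... | false = refl

<ᵇ-suc : ∀ {m k} → m ≢ k → (m <ᵇ suc k) ≡ (m <ᵇ k)
<ᵇ-suc {zero}  {zero}  m≢k = ⊥-elim (m≢k refl)
<ᵇ-suc {zero}  {suc k} m≢k = refl
<ᵇ-suc {suc m} {zero}  m≢k = refl
<ᵇ-suc {suc m} {suc k} m≢k = <ᵇ-suc (m≢k ∘ cong suc)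

module Ranking {n : ℕ} (key : Fin n → ℕ) (key-injective : Injective _≡_ _≡_ key) where

  rank : Fin n → ℕ
  rank x = count (λ y → key y <ᵇ key x)

  private
    ¬<ᵇ-refl : ∀ m → ¬ T (m <ᵇ m)
    ¬<ᵇ-refl m m<m = n≮n m (<ᵇ⇒< m m m<m)

  rank<n : ∀ x → rank x < n
  rank<n x = count<n _ x (¬<ᵇ-refl (key x))

  rank-strictMono : ∀ {x y} → key x < key y → rank x < rank y
  rank-strictMono {x} {y} kx<ky =
    count-< _ _ (λ i ki<kx → <⇒<ᵇ (<-trans (<ᵇ⇒< _ _ ki<kx) kx<ky))
            x (¬<ᵇ-refl (key x)) (<⇒<ᵇ kx<ky)

  rank-injective : Injective _≡_ _≡_ rank
  rank-injective {x} {y} rx≡ry with <-cmp (key x) (key y)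
  ... | tri< kx<ky _ _ = contradiction rx≡ry (<⇒≢ (rank-strictMono kx<ky))
  ... | tri≈ _ kx≡ky _ = key-injective kx≡ky
  ... | tri> _ _ ky<kx = contradiction (sym rx≡ry) (<⇒≢ (rank-strictMono ky<kx))

  rank-suc : ∀ {x y} → key y ≡ suc (key x) → rank y ≡ suc (rank x)
  rank-suc {x} {y} ky≡1+kx = count-insert _ _ x same-below (¬<ᵇ-refl (key x)) kx<ky
    where
      same-below : ∀ i → i ≢ x → (key i <ᵇ key x) ≡ (key i <ᵇ key y)
      same-below i i≢x rewrite ky≡1+kx = sym (<ᵇ-suc (i≢x ∘ key-injective))

      kx<ky : T (key x <ᵇ key y)
      kx<ky = <⇒<ᵇ (≤-reflexive (sym ky≡1+kx))

  ranking : Fin n → Fin n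
  ranking x = fromℕ< (rank<n x)

  toℕ-ranking : ∀ x → toℕ (ranking x) ≡ rank x
  toℕ-ranking x = toℕ-fromℕ< (rank<n x)

  ranking-bijective : Bijective _≡_ _≡_ ranking
  ranking-bijective = ranking-injective , injective⇒surjective ranking-injective
    where
      ranking-injective : Injective _≡_ _≡_ ranking
      ranking-injective {x} {y} e =
        rank-injective (trans (sym (toℕ-ranking x)) (trans (cong toℕ e) (toℕ-ranking y)))

  ranking-suc : ∀ {x y} → key y ≡ suc (key x) → toℕ (ranking y) ≡ suc (toℕ (ranking x))
  ranking-suc {x} {y} ky≡1+kx = begin
    toℕ (ranking y)       ≡⟨ toℕ-ranking y ⟩
    rank y                ≡⟨ rank-suc ky≡1+kx ⟩
    suc (rank x)          ≡⟨ cong suc (toℕ-ranking x) ⟨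
    suc (toℕ (ranking x)) ∎
    where open ≡-Reasoning

least : (ℕ → Bool) → ℕ → ℕ
least P zero    = zero
least P (suc k) = if P zero then zero else suc (least (P ∘ suc) k)

least-holds : ∀ (P : ℕ → Bool) k → T (P k) → T (P (least P k))
least-holds P zero    Pk = Pk
least-holds P (suc k) Pk with P zero in e
... | true  = subst T (sym e) tt
... | false = least-holds (P ∘ suc) k Pk

least-minimal : ∀ (P : ℕ → Bool) k j → T (P j) → least P k ≤ j
least-minimal P zero    j       Pj = z≤n
least-minimal P (suc k) j       Pj with P zero in e
least-minimal P (suc k) j       Pj | true  = z≤n
least-minimal P (suc k) zero    Pj | false = ⊥-elim (subst T e Pj)
least-minimal P (suc k) (suc j) Pj | false = s≤s (least-minimal (P ∘ suc) k j Pj)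

-- Graphs and rooted trees

module _ {n : ℕ} (G : Graph n) where

  Adj-sym : ∀ {u v} → Adj G u v → Adj G v u
  Adj-sym {u} {v} = subst T (Graph.sym G u v)

  Adj-irrefl : ∀ {u} → ¬ Adj G u u
  Adj-irrefl {u} = subst T (loopless G u)

  nbhd-adjacent : ∀ v → All (Adj G v) (nbhd G v)
  nbhd-adjacent v = All.tabulate (proj₂ ∘ ∈-filter⁻ (λ u → T? (adj G v u)) {xs = allFin n})

  adjacent⇒∈nbhd : ∀ {v u} → Adj G v u → u ∈ nbhd G v
  adjacent⇒∈nbhd {v} {u} = ∈-filter⁺ (λ u → T? (adj G v u)) (∈-allFin u)

  nbhd-unique : ∀ v → Unique (nbhd G v)
  nbhd-unique v = filter⁺ (λ u → T? (adj G v u)) (allFin⁺ n)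

module Distance {n : ℕ} (G : Graph n) (r : Fin n) (connected : Connected G) where

  reachesRootWithin : Fin n → ℕ → Bool
  reachesRootWithin u zero    = ⌊ u ≟ r ⌋
  reachesRootWithin u (suc k) =
    reachesRootWithin u k ∨ ⌊ any? (λ w → T? (adj G u w ∧ reachesRootWithin w k)) ⌋

  reachesRootWithin-step : ∀ {u w} k → Adj G u w → T (reachesRootWithin w k) →
                           T (reachesRootWithin u (suc k))
  reachesRootWithin-step {u} {w} k u~w w-reaches =
    Equivalence.from (T-∨ {reachesRootWithin u k})
      (inj₂ (fromWitness (w , Equivalence.from (T-∧ {adj G u w}) (u~w , w-reaches))))

  walk⇒reachesRootWithin : ∀ {u} → Walk G u r → ∃ λ k → T (reachesRootWithin u k)
  walk⇒reachesRootWithin here = 0 , fromWitness refl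
  walk⇒reachesRootWithin (step u~v walk) with walk⇒reachesRootWithin walk
  ... | k , v-reaches = suc k , reachesRootWithin-step k u~v v-reaches

  private
    searchBound : ∀ u → ∃ λ k → T (reachesRootWithin u k)
    searchBound u = walk⇒reachesRootWithin (connected u r)

  dist : Fin n → ℕ
  dist u = least (reachesRootWithin u) (proj₁ (searchBound u))

  dist-reaches : ∀ u → T (reachesRootWithin u (dist u))
  dist-reaches u = least-holds (reachesRootWithin u) (proj₁ (searchBound u)) (proj₂ (searchBound u))

  dist-minimal : ∀ {u} k → T (reachesRootWithin u k) → dist u ≤ k
  dist-minimal {u} = least-minimal (reachesRootWithin u) (proj₁ (searchBound u))

  dist≡0⇒root : ∀ {u} → dist u ≡ 0 → u ≡ r
  dist≡0⇒root {u} du≡0 = toWitness (subst (T ∘ reachesRootWithin u) du≡0 (dist-reaches u))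

  dist-adjacent : ∀ {u v} → Adj G u v → dist v ≤ suc (dist u)
  dist-adjacent {u} u~v =
    dist-minimal _ (reachesRootWithin-step (dist u) (Adj-sym G u~v) (dist-reaches u))

  closer-neighbour : ∀ {u k} → dist u ≡ suc k → ∃ λ w → Adj G u w × dist w ≡ k
  closer-neighbour {u} {k} du≡1+k
    with Equivalence.to (T-∨ {reachesRootWithin u k})
                        (subst (T ∘ reachesRootWithin u) du≡1+k (dist-reaches u))
  ... | inj₁ u-reaches = ⊥-elim (n≮n k (subst (_≤ k) du≡1+k (dist-minimal k u-reaches)))
  ... | inj₂ step-reaches with toWitness step-reaches
  ... | w , w-step with Equivalence.to (T-∧ {adj G u w}) w-step
  ... | u~w , w-reaches = w , u~w , ≤-antisym (dist-minimal k w-reaches) (≮⇒≥ dw≮k)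
    where
      dw≮k : ¬ dist w < k
      dw≮k dw<k = n≮n (dist u) (≤-<-trans (dist-adjacent (Adj-sym G u~w))
                                          (subst (suc (dist w) <_) (sym du≡1+k) (s≤s dw<k)))

  private
    parentAt : ∀ x m → dist x ≡ m → Fin n
    parentAt x zero    _   = x
    parentAt x (suc k) dx≡m = proj₁ (closer-neighbour dx≡m)

    parentAt-spec : ∀ x m (dx≡m : dist x ≡ m) {k} → m ≡ suc k →
                    Adj G x (parentAt x m dx≡m) × dist (parentAt x m dx≡m) ≡ k
    parentAt-spec x (suc k) dx≡m refl = proj₂ (closer-neighbour dx≡m)

  parent : Fin n → Fin n
  parent x = parentAt x (dist x) refl

  parent-spec : ∀ x {k} → dist x ≡ suc k → Adj G x (parent x) × dist (parent x) ≡ k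
  parent-spec x = parentAt-spec x (dist x) refl

module RootedTree {n : ℕ} (G : Graph n) (r : Fin n) (connected : Connected G) (acyclic : Acyclic G) where

  open Distance G r connected public

  Chain : Fin n → List (Fin n) → Fin n → Set
  Chain a []       b = a ≡ b
  Chain a (x ∷ xs) b = Adj G a x × Chain x xs b

  chain-∷ʳ : ∀ {a b c} ys → Chain a ys b → Adj G b c → Chain a (ys ∷ʳ c) c
  chain-∷ʳ []       refl        b~c = b~c , refl
  chain-∷ʳ (y ∷ ys) (a~y , ch) b~c = a~y , chain-∷ʳ ys ch b~c

  chain⇒closedPath : ∀ {x₀ a b} ys → Chain a ys b → Adj G b x₀ → ClosedPath G x₀ (a ∷ ys)
  chain⇒closedPath []       refl        b~x₀ = b~x₀
  chain⇒closedPath (y ∷ ys) (a~y , ch) b~x₀ = a~y , chain⇒closedPath ys ch b~x₀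

  simplePath-ends-nonadjacent : ∀ {u w} ys → Chain u ys w → Unique (u ∷ ys) → 2 ≤ length ys →
                                ¬ Adj G w u
  simplePath-ends-nonadjacent ys ch unique 2≤len w~u =
    acyclic (_ ∷ ys) (s≤s 2≤len , unique , chain⇒closedPath ys ch w~u)

  ShallowPath : ℕ → Fin n → List (Fin n) → Fin n → Set
  ShallowPath d u ys w = Chain u ys w × Unique (u ∷ ys) × All (λ x → dist x ≤ d) (u ∷ ys)

  -- Two vertices at the same depth are joined through their ancestors.
  shallowPath : ∀ d {u w} → dist u ≡ d → dist w ≡ d → ∃ λ ys → ShallowPath d u ys w
  detour : ∀ d {u w} → u ≢ w → dist u ≡ suc d → dist w ≡ suc d →
           ∃ λ ys → ShallowPath (suc d) u ys w × 2 ≤ length ys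

  shallowPath d {u} {w} du dw with u ≟ w
  shallowPath d       du dw | yes refl = [] , refl , [] ∷ [] , ≤-reflexive du ∷ []
  shallowPath zero    du dw | no u≢w  = ⊥-elim (u≢w (trans (dist≡0⇒root du) (sym (dist≡0⇒root dw))))
  shallowPath (suc d) du dw | no u≢w  = map₂ proj₁ (detour d u≢w du dw)

  detour d {u} {w} u≢w du dw with parent-spec u du | parent-spec w dw
  ... | u~pu , dpu | w~pw , dpw with shallowPath d dpu dpw
  ... | ys , ch , unique , low =
    parent u ∷ ys ∷ʳ w ,
    ( (u~pu , chain-∷ʳ ys ch (Adj-sym G w~pw))
    , unique-between dist u≢w (≤-reflexive (sym du)) (≤-reflexive (sym dw)) low unique
    , ≤-reflexive du ∷ ∷ʳ⁺ (All.map m≤n⇒m≤1+n low) (≤-reflexive dw)) ,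
    s≤s (subst (1 ≤_) (sym (length-++ ys)) (m≤n+m 1 (length ys)))

  adjacent⇒dist≢ : ∀ {u w} → Adj G u w → dist u ≢ dist w
  adjacent⇒dist≢ {u} {w} u~w du≡dw with dist u in du
  ... | zero  = Adj-irrefl G (subst (Adj G u) w≡u u~w)
    where
      w≡u : w ≡ u
      w≡u = trans (dist≡0⇒root (sym du≡dw)) (sym (dist≡0⇒root du))
  ... | suc d with detour d (λ { refl → Adj-irrefl G u~w }) du (sym du≡dw)
  ... | ys , (ch , unique , _) , 2≤len = simplePath-ends-nonadjacent ys ch unique 2≤len (Adj-sym G u~w)

  closer-unique : ∀ {v u w} → Adj G v u → Adj G v w →
                  suc (dist u) ≡ dist v → suc (dist w) ≡ dist v → u ≡ w
  closer-unique {v} {u} {w} v~u v~w du dw with u ≟ w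
  ... | yes u≡w = u≡w
  ... | no u≢w with shallowPath (dist u) refl (suc-injective (trans dw (sym du)))
  ... | []          , u≡w , _ = ⊥-elim (u≢w u≡w)
  ... | ys@(_ ∷ _) , ch , unique , low =
    ⊥-elim (simplePath-ends-nonadjacent (u ∷ ys) (v~u , ch) (higher-∉ dist (≤-reflexive du) low ∷ unique)
                                        (s≤s (s≤s z≤n)) (Adj-sym G v~w))

  parent-unique : ∀ {p x} → Adj G p x → dist x ≡ suc (dist p) → parent x ≡ p
  parent-unique {p} {x} p~x dx with parent-spec x dx
  ... | x~par , dpar =
    closer-unique x~par (Adj-sym G p~x) (trans (cong suc dpar) (sym dx)) (sym dx)

  neighbour-dist : ∀ {v u} → Adj G v u → dist u ≡ suc (dist v) ⊎ suc (dist u) ≡ dist v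
  neighbour-dist {v} {u} v~u with <-cmp (dist u) (dist v)
  ... | tri< du<dv _ _ = inj₂ (≤-antisym du<dv (dist-adjacent (Adj-sym G v~u)))
  ... | tri≈ _ du≡dv _ = ⊥-elim (adjacent⇒dist≢ v~u (sym du≡dv))
  ... | tri> _ _ dv<du = inj₁ (≤-antisym (dist-adjacent v~u) dv<du)

  Child : Fin n → Fin n → Set
  Child v u = Adj G v u × dist u ≡ suc (dist v)

  child⇒parent : ∀ {v u} → Child v u → parent u ≡ v
  child⇒parent (v~u , du) = parent-unique v~u du

  two-children : ∀ v → 3 ≤ deg G v → ∃₂ λ x y → x ≢ y × Child v x × Child v y
  two-children v 3≤deg =
    two-satisfying (λ (v~x , dx) (v~y , dy) → closer-unique v~x v~y dx dy) (nbhd-unique G v) 3≤deg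
      (All.map (λ v~u → Sum.map (v~u ,_) (v~u ,_) (neighbour-dist v~u)) (nbhd-adjacent G v))

module Labelling {n : ℕ} (G : Graph n) (r : Fin n) (connected : Connected G) (acyclic : Acyclic G)
                 (internal⇒deg≥3 : ∀ v → 1 < deg G v → 3 ≤ deg G v) where

  open RootedTree G r connected acyclic

  isChild : Fin n → Fin n → Bool
  isChild v u = adj G v u ∧ (dist u ≡ᵇ suc (dist v))

  childList : Fin n → List (Fin n)
  childList v = filter (λ u → T? (isChild v u)) (allFin n)

  child⇒∈childList : ∀ {v u} → Child v u → u ∈ childList v
  child⇒∈childList {v} {u} (v~u , du) =
    ∈-filter⁺ (λ u → T? (isChild v u)) (∈-allFin u) (Equivalence.from T-∧ (v~u , ≡⇒≡ᵇ _ _ du))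

  ∈childList⇒child : ∀ {v u} → u ∈ childList v → Child v u
  ∈childList⇒child {v} {u} u∈ with ∈-filter⁻ (λ u → T? (isChild v u)) {xs = allFin n} u∈
  ... | _ , is-child with Equivalence.to (T-∧ {adj G v u}) is-child
  ... | v~u , du = v~u , ≡ᵇ⇒≡ _ _ du

  firstChild secondChild : Fin n → Fin n
  firstChild  v = proj₁ (firstTwo v (childList v))
  secondChild v = proj₂ (firstTwo v (childList v))

  chosen-children : ∀ v → 1 < deg G v →
                    firstChild v ≢ secondChild v × Child v (firstChild v) × Child v (secondChild v)
  chosen-children v 1<deg with two-children v (internal⇒deg≥3 v 1<deg)
  ... | x , y , x≢y , cx , cy
    with firstTwo-distinct v (filter⁺ (λ u → T? (isChild v u)) (allFin⁺ n))
                           (child⇒∈childList cx) (child⇒∈childList cy) x≢y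
  ... | c₁≢c₂ , c₁∈ , c₂∈ = c₁≢c₂ , ∈childList⇒child c₁∈ , ∈childList⇒child c₂∈

  isSecondChild : Fin n → Bool
  isSecondChild x = (1 <ᵇ deg G (parent x)) ∧ ⌊ secondChild (parent x) ≟ x ⌋

  sibling : Fin n → Fin n
  sibling x = firstChild (parent x)

  key : Fin n → ℕ
  key x = if isSecondChild x then suc (2 * toℕ (sibling x)) else 2 * toℕ x

  key-second : ∀ {x} → T (isSecondChild x) → key x ≡ suc (2 * toℕ (sibling x))
  key-second {x} second with isSecondChild x
  ... | true = refl

  key-other : ∀ {x} → ¬ T (isSecondChild x) → key x ≡ 2 * toℕ x
  key-other {x} ¬second with isSecondChild x
  ... | true  = ⊥-elim (¬second tt)
  ... | false = refl

  isSecondChild⇒ : ∀ {x} → T (isSecondChild x) → 1 < deg G (parent x) × secondChild (parent x) ≡ x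
  isSecondChild⇒ {x} second with Equivalence.to (T-∧ {1 <ᵇ deg G (parent x)}) second
  ... | internal , is-second = <ᵇ⇒< 1 _ internal , toWitness is-second

  secondChild-isSecondChild : ∀ v → 1 < deg G v → T (isSecondChild (secondChild v))
  secondChild-isSecondChild v 1<deg =
    subst (λ p → T ((1 <ᵇ deg G p) ∧ ⌊ secondChild p ≟ secondChild v ⌋))
          (sym (child⇒parent (proj₂ (proj₂ (chosen-children v 1<deg)))))
          (Equivalence.from T-∧ (<⇒<ᵇ 1<deg , fromWitness refl))

  firstChild-¬isSecondChild : ∀ v → 1 < deg G v → ¬ T (isSecondChild (firstChild v))
  firstChild-¬isSecondChild v 1<deg second with chosen-children v 1<deg
  ... | c₁≢c₂ , c₁-child , _ =
    c₁≢c₂ (sym (trans (cong secondChild (sym (child⇒parent c₁-child))) (proj₂ (isSecondChild⇒ second))))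

  sibling-injective : ∀ {x y} → T (isSecondChild x) → T (isSecondChild y) → sibling x ≡ sibling y → x ≡ y
  sibling-injective {x} {y} sx sy same-sibling
    with isSecondChild⇒ sx | isSecondChild⇒ sy
  ... | px-internal , c₂px≡x | py-internal , c₂py≡y = begin
    x                       ≡⟨ c₂px≡x ⟨
    secondChild (parent x)  ≡⟨ cong secondChild px≡py ⟩
    secondChild (parent y)  ≡⟨ c₂py≡y ⟩
    y                       ∎
    where
      open ≡-Reasoning
      px≡py : parent x ≡ parent y
      px≡py = begin
        parent x            ≡⟨ child⇒parent (proj₁ (proj₂ (chosen-children _ px-internal))) ⟨
        parent (sibling x)  ≡⟨ cong parent same-sibling ⟩
        parent (sibling y)  ≡⟨ child⇒parent (proj₁ (proj₂ (chosen-children _ py-internal))) ⟩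
        parent y            ∎

  key-injective : Injective _≡_ _≡_ key
  key-injective {x} {y} kx≡ky with T? (isSecondChild x) | T? (isSecondChild y)
  ... | no ¬sx | no ¬sy =
    toℕ-injective (*-cancelˡ-≡ _ _ 2 (trans (sym (key-other ¬sx)) (trans kx≡ky (key-other ¬sy))))
  ... | yes sx | yes sy = sibling-injective sx sy (toℕ-injective (*-cancelˡ-≡ _ _ 2
    (suc-injective (trans (sym (key-second sx)) (trans kx≡ky (key-second sy))))))
  ... | no ¬sx | yes sy =
    ⊥-elim (even≢odd (toℕ x) (toℕ (sibling y))
                     (trans (sym (key-other ¬sx)) (trans kx≡ky (key-second sy))))
  ... | yes sx | no ¬sy =
    ⊥-elim (even≢odd (toℕ y) (toℕ (sibling x))
                     (trans (sym (key-other ¬sy)) (trans (sym kx≡ky) (key-second sx))))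

  key-secondChild : ∀ v → 1 < deg G v → key (secondChild v) ≡ suc (key (firstChild v))
  key-secondChild v 1<deg = begin
    key (secondChild v)                         ≡⟨ key-second (secondChild-isSecondChild v 1<deg) ⟩
    suc (2 * toℕ (sibling (secondChild v)))     ≡⟨ cong (λ p → suc (2 * toℕ (firstChild p))) c₂-parent ⟩
    suc (2 * toℕ (firstChild v))                ≡⟨ cong suc (key-other (firstChild-¬isSecondChild v 1<deg)) ⟨
    suc (key (firstChild v))                    ∎
    where
      open ≡-Reasoning
      c₂-parent : parent (secondChild v) ≡ v
      c₂-parent = child⇒parent (proj₂ (proj₂ (chosen-children v 1<deg)))

  open Ranking key key-injective

  neighborhoodPrime : NeighborhoodPrime G
  neighborhoodPrime = ranking , ranking-bijective , gcd≡1
    where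
      label : Fin n → ℕ
      label u = suc (toℕ (ranking u))

      gcd≡1 : ∀ v → 1 < deg G v → foldr gcd 0 (map label (nbhd G v)) ≡ 1
      gcd≡1 v 1<deg with chosen-children v 1<deg
      ... | _ , (v~c₁ , _) , (v~c₂ , _) =
        gcdList-consecutive _ (∈-map⁺ label (adjacent⇒∈nbhd G v~c₁))
          (subst (_∈ map label (nbhd G v)) (cong suc (ranking-suc (key-secondChild v 1<deg)))
                 (∈-map⁺ label (adjacent⇒∈nbhd G v~c₂)))

tree⇒neighborhoodPrime : ∀ {n} (G : Graph n) → IsTree G → (∀ v → 1 < deg G v → 3 ≤ deg G v) →
                         NeighborhoodPrime G
tree⇒neighborhoodPrime {suc _} G (_ , connected , acyclic) =
  Labelling.neighborhoodPrime G zero connected acyclic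

fullKary⇒internal-deg≥3 : ∀ {n k} → 3 ≤ k → (G : Graph n) (r : Fin n) →
  (∀ v → children G r v ≡ 0 ⊎ children G r v ≡ k) → ∀ v → 1 < deg G v → 3 ≤ deg G v
fullKary⇒internal-deg≥3 3≤k G r arity v 1<deg with v ≟ r | arity v
... | yes _ | inj₁ deg≡0 = ⊥-elim (<⇒≢ (<-trans (s≤s z≤n) 1<deg) (sym deg≡0))
... | yes _ | inj₂ deg≡k = subst (3 ≤_) (sym deg≡k) 3≤k
... | no _  | inj₁ deg∸1≡0 = ⊥-elim (n≮n 1 (≤-trans 1<deg (m∸n≡0⇒m≤n deg∸1≡0)))
... | no _  | inj₂ deg∸1≡k = ≤-trans 3≤k (≤-trans (≤-reflexive (sym deg∸1≡k)) (m∸n≤m (deg G v) 1))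

mainTheorem16 : (k : ℕ) → 3 ≤ k →
    ((n : ℕ) (G : Graph n) → IsFullKaryTree G k → NeighborhoodPrime G) ×
    ((n : ℕ) (G : Graph n) → IsCayleyTree G k → NeighborhoodPrime G)
mainTheorem16 k 3≤k = fullKary , cayley
  where
    fullKary : (n : ℕ) (G : Graph n) → IsFullKaryTree G k → NeighborhoodPrime G
    fullKary n G (tree , r , arity) =
      tree⇒neighborhoodPrime G tree (fullKary⇒internal-deg≥3 3≤k G r arity)

    cayley : (n : ℕ) (G : Graph n) → IsCayleyTree G k → NeighborhoodPrime G
    cayley n G (tree , regular) =
      tree⇒neighborhoodPrime G tree λ v 1<deg → subst (3 ≤_) (sym (regular v 1<deg)) 3≤k
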